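{- Let $\mathcal R_1$ and $\mathcal R_2$ be two $\Sigma$-structures that are one-binding bisimilar. Then for every OBFOL sentence $\varphi$ over $\Sigma(\mathrm{Var})$, $\mathcal R_1\models\varphi$ iff $\mathcal R_2\models\varphi$.
   Context: Language signature $\Sigma=(\mathrm{Args},\mathrm{Rels},\mathrm{ar})$: $\mathrm{Args},\mathrm{Rels}$ finite non-empty, $\mathrm{ar}:\mathrm{Rels}\to\mathcal P(\mathrm{Args})\setminus\{\emptyset\}$. A $\Sigma$-structure $\mathcal R=(D,\cdot^{\mathcal R})$ has non-empty domain $D$ and, for each $r$, a set $r^{\mathcal R}$ of functions $\mathrm{ar}(r)\to D$. FOL formulas: $\varphi::= r\mid\neg\varphi\mid\varphi\wedge\varphi\mid\varphi\vee\varphi\mid\exists x.\varphi\mid\forall x.\varphi\mid(a,x)\varphi$. Free placeholders: $\mathrm{free}(r)=\mathrm{ar}(r)$; unchanged by $\neg$; union for $\wedge,\vee$; $\mathrm{free}(Qx.\varphi)=\mathrm{free}(\varphi)\setminus\{x\}$; $\mathrm{free}((a,x)\varphi)=(\mathrm{free}(\varphi)\setminus\{a\})\cup\{x\}$ if $a\in\mathrm{free}(\varphi)$, else $\mathrm{free}(\varphi)$; sentences have none. Semantics with partial assignments $\chi:\mathrm{Args}\cup\mathrm{Var}\rightharpoonup D$: $\mathcal R,\chi\models r$ iff $\chi|_{\mathrm{ar}(r)}\in r^{\mathcal R}$; usual Boolean and quantifier clauses; $\mathcal R,\chi\models(a,x)\varphi$ iff $\mathcal R,\chi[a\mapsto\chi(x)]\models\varphi$;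 $\mathcal R\models\varphi$ iff $\mathcal R,\emptyset\models\varphi$. A quantification prefix is a finite word over $\{\exists x,\forall x\}$ with each variable at most once; a binding prefix is a finite word over pairs $(a,x)$ with each argument at most once; a derived relation is a Boolean combination of relations all having the same argument set. OBFOL formulas: $\varphi::=\wp\flat\bar r\mid(\varphi\wedge\varphi)\mid(\varphi\vee\varphi)$ with $\wp$ a quantification prefix, $\flat$ a binding prefix, $\bar r$ a derived relation. For a set $A\subseteq\mathrm{Args}$ and domain $D$, $\mathrm{Asg}_D(A)$ is the set of functions $A\to D$. For an assignment $\chi$, a set $P$ and $d\in D$, $\chi[P\mapsto d]$ is the assignment on $\mathrm{dom}(\chi)\cup P$ equal to $d$ on $P$ and to $\chi$ elsewhere. Structures $\mathcal R_1=(D_1,\cdot^{\mathcal R_1})$, $\mathcal R_2=(D_2,\cdot^{\mathcal R_2})$ are one-binding bisimilar iff there is a total relation $Z\subseteq\bigcup_{A\subseteq\mathrm{Args}}\mathrm{Asg}_{D_1}(A)\times\mathrm{Asg}_{D_2}(A)$ such that: (1) for all $A\subseteq\mathrm{Args}$, $A'\subseteq\mathrm{Args}\setminus A$, $\chi_1\in\mathrm{Asg}_{D_1}(A)$, $\chi_2\in\mathrm{Asg}_{D_2}(A)$ with $\chi_1 Z\chi_2$: (forth) for every $d_1\in D_1$ there is $d_2\in D_2$ with $\chi_1[A'\mapsto d_1]\,Z\,\chi_2[A'\mapsto d_2]$; (back) for every $d_2\in D_2$ there is $d_1\in D_1$ with $\chi_1[A'\mapsto d_1]\,Z\,\chi_2[A'\mapsto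 d_2]$; (2) for all $r\in\mathrm{Rels}$, $\chi_1\in\mathrm{Asg}_{D_1}(\mathrm{ar}(r))$, $\chi_2\in\mathrm{Asg}_{D_2}(\mathrm{ar}(r))$ with $\chi_1Z\chi_2$: $\chi_1\in r^{\mathcal R_1}$ iff $\chi_2\in r^{\mathcal R_2}$. -}

module Defs where

open import Data.Nat using (ℕ; _≤_)
open import Data.Fin using (Fin)
open import Data.Fin.Subset using (Subset; Nonempty; _⊆_; ∁) renaming (_∈_ to _∈ₛ_)
open import Data.Bool using (Bool; true; false; if_then_else_)
open import Data.Maybe using (Maybe; just; nothing; is-just)
open import Data.Vec using (Vec; map; zipWith; replicate; lookup)
open import Data.List using (List) renaming (map to lmap)
open import Data.List.Relation.Unary.Unique.Propositional using (Unique)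
open import Data.Product using (Σ; ∃; _×_; _,_; proj₁; proj₂)
open import Data.Sum using (_⊎_; inj₁; inj₂)
open import Relation.Nullary using (¬_)
open import Relation.Binary.PropositionalEquality using (_≡_; _≢_)
open import Function.Bundles using (_⇔_)

record Signature : Set where
  field
    nArgs  : ℕ
    nRels  : ℕ
    argsNE : 1 ≤ nArgs
    relsNE : 1 ≤ nRels
    ar     : Fin nRels → Subset nArgs
    arNE   : ∀ r → Nonempty (ar r)

Var : Set
Var = ℕ

module _ (Sg : Signature) where
  open Signature Sg

  Args : Set
  Args = Fin nArgs

  Rels : Set
  Rels = Fin nRels

  -- Partial assignments on Args over a domain D: a vector of optional
  -- values; its domain is the set of defined positions.
  -- Asg_D(A) = { χ | dom χ ≡ A }.

  ArgAsg : Set → Set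
  ArgAsg D = Vec (Maybe D) nArgs

  dom : {D : Set} → ArgAsg D → Subset nArgs
  dom χ = map is-just χ

  emptyArgAsg : {D : Set} → ArgAsg D
  emptyArgAsg = replicate _ nothing

  restrict : {D : Set} → Subset nArgs → ArgAsg D → ArgAsg D
  restrict A χ = zipWith (λ b m → if b then m else nothing) A χ

  updSet : {D : Set} → ArgAsg D → Subset nArgs → D → ArgAsg D
  updSet χ P d = zipWith (λ b m → if b then just d else m) P χ

  updArg : {D : Set} → ArgAsg D → Args → Maybe D → ArgAsg D
  updArg χ a m = Data.Vec.updateAt χ a (λ _ → m)

  -- Σ-structures: non-empty domain D and, for each r, a set r^R of
  -- functions ar(r) → D, i.e. a set of assignments with domain ar(r).

  record Structure : Set₁ where
    field
      D      : Set
      inhab  : D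
      rel    : Rels → ArgAsg D → Set
      relDom : ∀ r χ → rel r χ → dom χ ≡ ar r

  data Formula : Set where
    atom : Rels → Formula
    ¬'_  : Formula → Formula
    _∧'_ : Formula → Formula → Formula
    _∨'_ : Formula → Formula → Formula
    ∃'   : Var → Formula → Formula
    ∀'   : Var → Formula → Formula
    bind : Args → Var → Formula → Formula

  Placeholder : Set
  Placeholder = Args ⊎ Var

  FreeIn : Placeholder → Formula → Set
  FreeIn (inj₁ a) (atom r) = a ∈ₛ ar r
  FreeIn (inj₂ x) (atom r) = Data.Empty.⊥
    where import Data.Empty
  FreeIn p (¬' φ)    = FreeIn p φ
  FreeIn p (φ ∧' ψ)  = FreeIn p φ ⊎ FreeIn p ψ
  FreeIn p (φ ∨' ψ)  = FreeIn p φ ⊎ FreeIn p ψ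
  FreeIn p (∃' x φ)  = FreeIn p φ × p ≢ inj₂ x
  FreeIn p (∀' x φ)  = FreeIn p φ × p ≢ inj₂ x
  FreeIn p (bind a x φ) =
      (FreeIn (inj₁ a) φ × (p ≡ inj₂ x ⊎ (FreeIn p φ × p ≢ inj₁ a)))
    ⊎ (¬ FreeIn (inj₁ a) φ × FreeIn p φ)

  Sentence : Formula → Set
  Sentence φ = ∀ p → ¬ FreeIn p φ

  -- Semantics with partial assignments χ : Args ∪ Var ⇀ D

  Asgn : Set → Set
  Asgn D = ArgAsg D × (Var → Maybe D)

  updVar : {D : Set} → (Var → Maybe D) → Var → D → (Var → Maybe D)
  updVar η x d y with y Data.Nat.≟ x
    where import Data.Nat
  ... | Relation.Nullary.yes _ = just d
    where import Relation.Nullary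
  ... | Relation.Nullary.no _ = η y
    where import Relation.Nullary

  module _ (R : Structure) where
    open Structure R

    Sat : Asgn D → Formula → Set
    Sat (χ , η) (atom r)   = rel r (restrict (ar r) χ)
    Sat χ (¬' φ)           = ¬ Sat χ φ
    Sat χ (φ ∧' ψ)         = Sat χ φ × Sat χ ψ
    Sat χ (φ ∨' ψ)         = Sat χ φ ⊎ Sat χ ψ
    Sat (χ , η) (∃' x φ)   = Σ D λ d → Sat (χ , updVar η x d) φ
    Sat (χ , η) (∀' x φ)   = (d : D) → Sat (χ , updVar η x d) φ
    Sat (χ , η) (bind a x φ) = Sat (updArg χ a (η x) , η) φ

    Models : Formula → Set
    Models φ = Sat (emptyArgAsg , (λ _ → nothing)) φ

  data Quant : Set where
    ex all : Quant

  QPrefix : Set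
  QPrefix = List (Quant × Var)

  applyQ : QPrefix → Formula → Formula
  applyQ Data.List.[] φ = φ
  applyQ ((ex , x) Data.List.∷ ℘) φ = ∃' x (applyQ ℘ φ)
  applyQ ((all , x) Data.List.∷ ℘) φ = ∀' x (applyQ ℘ φ)

  IsQPrefix : QPrefix → Set
  IsQPrefix ℘ = Unique (lmap proj₂ ℘)

  BPrefix : Set
  BPrefix = List (Args × Var)

  applyB : BPrefix → Formula → Formula
  applyB Data.List.[] φ = φ
  applyB ((a , x) Data.List.∷ ♭) φ = bind a x (applyB ♭ φ)

  IsBPrefix : BPrefix → Set
  IsBPrefix ♭ = Unique (lmap proj₁ ♭)

  data Derived (A : Subset nArgs) : Formula → Set where
    d-atom : ∀ r → ar r ≡ A → Derived A (atom r)
    d-neg  : ∀ {φ} → Derived A φ → Derived A (¬' φ)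
    d-and  : ∀ {φ ψ} → Derived A φ → Derived A ψ → Derived A (φ ∧' ψ)
    d-or   : ∀ {φ ψ} → Derived A φ → Derived A ψ → Derived A (φ ∨' ψ)

  IsDerived : Formula → Set
  IsDerived φ = Σ (Subset nArgs) λ A → Derived A φ

  data IsOBFOL : Formula → Set where
    ob-basic : ∀ ℘ ♭ φ → IsQPrefix ℘ → IsBPrefix ♭ → IsDerived φ →
               IsOBFOL (applyQ ℘ (applyB ♭ φ))
    ob-and   : ∀ {φ ψ} → IsOBFOL φ → IsOBFOL ψ → IsOBFOL (φ ∧' ψ)
    ob-or    : ∀ {φ ψ} → IsOBFOL φ → IsOBFOL ψ → IsOBFOL (φ ∨' ψ)

  module _ (R₁ R₂ : Structure) where
    private
      D₁ = Structure.D R₁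
      D₂ = Structure.D R₂

    record IsOneBindingBisim (Z : ArgAsg D₁ → ArgAsg D₂ → Set) : Set₁ where
      field
        sameDom : ∀ {χ₁ χ₂} → Z χ₁ χ₂ → dom χ₁ ≡ dom χ₂
        total   : ∀ (χ₁ : ArgAsg D₁) → ∃ λ χ₂ → Z χ₁ χ₂
        forth   : ∀ (A A' : Subset nArgs) → A' ⊆ ∁ A →
                  ∀ χ₁ χ₂ → dom χ₁ ≡ A → dom χ₂ ≡ A → Z χ₁ χ₂ →
                  ∀ (d₁ : D₁) → ∃ λ (d₂ : D₂) →
                    Z (updSet χ₁ A' d₁) (updSet χ₂ A' d₂)
        back    : ∀ (A A' : Subset nArgs) → A' ⊆ ∁ A →
                  ∀ χ₁ χ₂ → dom χ₁ ≡ A → dom χ₂ ≡ A → Z χ₁ χ₂ →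
                  ∀ (d₂ : D₂) → ∃ λ (d₁ : D₁) →
                    Z (updSet χ₁ A' d₁) (updSet χ₂ A' d₂)
        atomic  : ∀ (r : Rels) χ₁ χ₂ → dom χ₁ ≡ ar r → dom χ₂ ≡ ar r →
                  Z χ₁ χ₂ →
                  (Structure.rel R₁ r χ₁ ⇔ Structure.rel R₂ r χ₂)

    OneBindingBisimilar : Set₁
    OneBindingBisimilar =
      Σ (ArgAsg D₁ → ArgAsg D₂ → Set) IsOneBindingBisim

-- By induction on the OBFOL sentence, the only interesting case is a basic
-- sentence  ℘ ♭ r̄  with r̄ a derived relation over an argument set A.  The
-- binding prefix ♭ determines a template: a vector saying which variable each
-- argument in A is bound to.  Instantiating the template with a variable
-- environment η yields an argument assignment  inst η  which, by the
-- semantics of bindings, is exactly what r̄ is evaluated on.  We walk through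
-- the quantifier prefix keeping the invariant  Z (inst η₁) (inst η₂) : giving
-- the next variable x a value updates  inst η  on the argument set holding x,
-- which is disjoint from its current domain because ℘ quantifies x only once,
-- so the forth/back clauses of Z let us match values in both structures.
-- Since the sentence is closed, every argument of A is bound to a variable
-- of ℘, so at the end  inst η  has domain A and the atomic clause of Z
-- compares the relations of r̄.

module Submission where

open import Defs
open import Function.Base using (_∘_)
open import Function.Bundles using (_⇔_; mk⇔; Equivalence)
open import Function.Related.TypeIsomorphisms using (¬-cong-⇔)
open import Data.Nat as ℕ using ()
open import Data.Fin as Fin using ()
open import Data.Fin.Subset using (Subset; _⊆_; ∁)
open import Data.Bool using (Bool; true; false; if_then_else_; not)
open import Data.Maybe using (Maybe; just; nothing; is-just; _>>=_)
open import Data.Vec using (Vec; lookup; map; replicate)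
open import Data.Vec.Properties
  using (lookup-map; lookup-zipWith; lookup-replicate; map-replicate; map-updateAt;
         lookup∘updateAt; lookup∘updateAt′; []=⇒lookup; lookup⇒[]=; tabulate∘lookup; tabulate-cong)
open import Data.List using (List; []; _∷_) renaming (map to lmap)
open import Data.List.Relation.Unary.Any using (here; there)
import Data.List.Relation.Unary.All as All
open import Data.List.Relation.Unary.AllPairs using (_∷_)
open import Data.List.Membership.Propositional using (_∈_; _∉_)
open import Data.List.Membership.DecPropositional ℕ._≟_ using (_∈?_)
open import Data.Product using (Σ; ∃; _×_; _,_; proj₂)
open import Data.Product.Function.NonDependent.Propositional using (_×-⇔_)
open import Data.Sum using (_⊎_; inj₁; inj₂)
open import Data.Sum.Function.Propositional using (_⊎-⇔_)
open import Data.Sum.Properties using (inj₁-injective)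
open import Data.Empty using (⊥-elim)
open import Relation.Nullary using (¬_; Dec; yes; no)
open import Relation.Nullary.Decidable using (⌊_⌋)
open import Relation.Binary.PropositionalEquality
  using (_≡_; _≢_; ≢-sym; refl; sym; trans; cong; cong₂; subst; subst₂; module ≡-Reasoning)

open Equivalence using (to; from)

vecExt : ∀ {X : Set} {k} {u v : Vec X k} → (∀ i → lookup u i ≡ lookup v i) → u ≡ v
vecExt {u = u} {v} h = trans (sym (tabulate∘lookup u)) (trans (tabulate-cong h) (tabulate∘lookup v))

module Transfer {X₁ X₂ : Set} (Partner : X₁ → X₂ → Set)
                (forth : ∀ d₁ → ∃ (Partner d₁)) (back : ∀ d₂ → ∃ λ d₁ → Partner d₁ d₂)
                {S₁ : X₁ → Set} {S₂ : X₂ → Set}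
                (step : ∀ {d₁ d₂} → Partner d₁ d₂ → S₁ d₁ ⇔ S₂ d₂) where

  Σ-transfer : Σ X₁ S₁ ⇔ Σ X₂ S₂
  Σ-transfer = mk⇔
    (λ { (d₁ , s) → let (d₂ , p) = forth d₁ in d₂ , to (step p) s })
    (λ { (d₂ , s) → let (d₁ , p) = back d₂ in d₁ , from (step p) s })

  Π-transfer : ((d : X₁) → S₁ d) ⇔ ((d : X₂) → S₂ d)
  Π-transfer = mk⇔
    (λ f d₂ → let (d₁ , p) = back d₂ in to (step p) (f d₁))
    (λ f d₁ → let (d₂ , p) = forth d₁ in from (step p) (f d₂))

module _ (Sg : Signature) where
  open Signature Sg

  lookup-restrict : ∀ {D : Set} A (χ : ArgAsg Sg D) a →
                    lookup (restrict Sg A χ) a ≡ (if lookup A a then lookup χ a else nothing)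
  lookup-restrict A χ a = lookup-zipWith _ a A χ

  lookup-updSet : ∀ {D : Set} (χ : ArgAsg Sg D) P d a →
                  lookup (updSet Sg χ P d) a ≡ (if lookup P a then just d else lookup χ a)
  lookup-updSet χ P d a = lookup-zipWith _ a P χ

  lookup-dom : ∀ {D : Set} (χ : ArgAsg Sg D) a → lookup (dom Sg χ) a ≡ is-just (lookup χ a)
  lookup-dom χ a = lookup-map a is-just χ

  lookup-updArg-same : ∀ {D : Set} (χ : ArgAsg Sg D) b m → lookup (updArg Sg χ b m) b ≡ m
  lookup-updArg-same χ b m = lookup∘updateAt b χ

  lookup-updArg-other : ∀ {D : Set} (χ : ArgAsg Sg D) {b a} m → b ≢ a →
                        lookup (updArg Sg χ b m) a ≡ lookup χ a
  lookup-updArg-other χ m b≢a = lookup∘updateAt′ _ _ (b≢a ∘ sym) χ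

  dom-emptyArgAsg : ∀ {D : Set} → dom Sg (emptyArgAsg Sg {D}) ≡ replicate nArgs false
  dom-emptyArgAsg = map-replicate is-just nothing nArgs

  empty-dom : ∀ {D : Set} (χ : ArgAsg Sg D) → dom Sg χ ≡ replicate nArgs false → χ ≡ emptyArgAsg Sg
  empty-dom χ e = vecExt λ a → trans (undefined (lookup χ a) (entry a)) (sym (lookup-replicate a nothing))
    where
    entry : ∀ a → is-just (lookup χ a) ≡ false
    entry a = trans (sym (lookup-dom χ a)) (trans (cong (λ v → lookup v a) e) (lookup-replicate a false))
    undefined : ∀ {D : Set} (m : Maybe D) → is-just m ≡ false → m ≡ nothing
    undefined nothing _ = refl

  updVar-same : ∀ {D : Set} (η : Var → Maybe D) x d → updVar Sg η x d x ≡ just d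
  updVar-same η x d with x ℕ.≟ x
  ... | yes _ = refl
  ... | no x≢x = ⊥-elim (x≢x refl)

  updVar-other : ∀ {D : Set} (η : Var → Maybe D) x d y → y ≢ x → updVar Sg η x d y ≡ η y
  updVar-other η x d y y≢x with y ℕ.≟ x
  ... | yes y≡x = ⊥-elim (y≢x y≡x)
  ... | no _ = refl

  free-under-quantifiers : ∀ ℘ {p ψ} → FreeIn Sg p ψ →
                           (∀ y → p ≡ inj₂ y → y ∉ lmap proj₂ ℘) → FreeIn Sg p (applyQ Sg ℘ ψ)
  free-under-quantifiers [] f _ = f
  free-under-quantifiers ((ex , x) ∷ ℘) {inj₁ a} f nq = free-under-quantifiers ℘ f (λ y e → nq y e ∘ there) , λ ()
  free-under-quantifiers ((ex , x) ∷ ℘) {inj₂ y} f nq = free-under-quantifiers ℘ f (λ y e → nq y e ∘ there) , λ e → nq x e (here refl)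
  free-under-quantifiers ((all , x) ∷ ℘) {inj₁ a} f nq = free-under-quantifiers ℘ f (λ y e → nq y e ∘ there) , λ ()
  free-under-quantifiers ((all , x) ∷ ℘) {inj₂ y} f nq = free-under-quantifiers ℘ f (λ y e → nq y e ∘ there) , λ e → nq x e (here refl)

  -- Binding another argument b does not capture p.  (Which disjunct of the
  -- definition applies depends on whether b is free, hence the double negation.)
  free-after-binding : ∀ {p b x ψ} → p ≢ inj₁ b → FreeIn Sg p ψ → ¬ ¬ FreeIn Sg p (bind b x ψ)
  free-after-binding {inj₁ a} p≢b f k = k (inj₂ ((λ fb → k (inj₁ (fb , inj₂ (f , p≢b)))) , f))
  free-after-binding {inj₂ y} p≢b f k = k (inj₂ ((λ fb → k (inj₁ (fb , inj₂ (f , p≢b)))) , f))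

  derived-free : ∀ {A φ a} → Derived Sg A φ → lookup A a ≡ true → FreeIn Sg (inj₁ a) φ
  derived-free {a = a} (d-atom r refl) a∈A = lookup⇒[]= a (ar r) a∈A
  derived-free (d-neg d) a∈A = derived-free d a∈A
  derived-free (d-and d _) a∈A = inj₁ (derived-free d a∈A)
  derived-free (d-or d _) a∈A = inj₁ (derived-free d a∈A)

  sentence-∧ : ∀ {φ ψ} → Sentence Sg (φ ∧' ψ) → Sentence Sg φ × Sentence Sg ψ
  sentence-∧ s = (λ { (inj₁ a) f → s (inj₁ a) (inj₁ f) ; (inj₂ x) f → s (inj₂ x) (inj₁ f) })
               , (λ { (inj₁ a) f → s (inj₁ a) (inj₂ f) ; (inj₂ x) f → s (inj₂ x) (inj₂ f) })

  sentence-∨ : ∀ {φ ψ} → Sentence Sg (φ ∨' ψ) → Sentence Sg φ × Sentence Sg ψ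
  sentence-∨ s = (λ { (inj₁ a) f → s (inj₁ a) (inj₁ f) ; (inj₂ x) f → s (inj₂ x) (inj₁ f) })
               , (λ { (inj₁ a) f → s (inj₁ a) (inj₂ f) ; (inj₂ x) f → s (inj₂ x) (inj₂ f) })

  bindArgs : ∀ {D : Set} → BPrefix Sg → ArgAsg Sg D → (Var → Maybe D) → ArgAsg Sg D
  bindArgs [] χ η = χ
  bindArgs ((a , x) ∷ ♭) χ η = bindArgs ♭ (updArg Sg χ a (η x)) η

  sat-bindings : ∀ R ♭ χ η φ → Sat Sg R (χ , η) (applyB Sg ♭ φ) ≡ Sat Sg R (bindArgs ♭ χ η , η) φ
  sat-bindings R [] χ η φ = refl
  sat-bindings R ((a , x) ∷ ♭) χ η φ = sat-bindings R ♭ (updArg Sg χ a (η x)) η φ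

  bindArgs-subst : ∀ {D : Set} ♭ (χ : ArgAsg Sg Var) (η : Var → Maybe D) →
                   bindArgs ♭ (map (_>>= η) χ) η ≡ map (_>>= η) (bindArgs ♭ χ just)
  bindArgs-subst [] χ η = refl
  bindArgs-subst ((a , x) ∷ ♭) χ η =
    trans (cong (λ χ' → bindArgs ♭ χ' η) (sym (map-updateAt χ a refl)))
          (bindArgs-subst ♭ (updArg Sg χ a (just x)) η)

  ArgumentFate : BPrefix Sg → ArgAsg Sg Var → Args Sg → Formula Sg → Set
  ArgumentFate ♭ χ a φ =
      (FreeIn Sg (inj₁ a) (applyB Sg ♭ φ) × lookup (bindArgs ♭ χ just) a ≡ lookup χ a)
    ⊎ Σ Var λ y → FreeIn Sg (inj₂ y) (applyB Sg ♭ φ) × lookup (bindArgs ♭ χ just) a ≡ just y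

  argument-fate : ∀ ♭ χ {a φ} → FreeIn Sg (inj₁ a) φ → ¬ ¬ ArgumentFate ♭ χ a φ
  argument-fate [] χ f k = k (inj₁ (f , refl))
  argument-fate ((b , x) ∷ ♭) χ {a} {φ} f k = argument-fate ♭ (updArg Sg χ b (just x)) f lift
    where
    lift : ¬ ArgumentFate ♭ (updArg Sg χ b (just x)) a φ
    lift (inj₂ (y , fy , e)) = free-after-binding {inj₂ y} {b} {x} {applyB Sg ♭ φ} (λ ()) fy
                                 λ fy' → k (inj₂ (y , fy' , e))
    lift (inj₁ (fa , e)) with b Fin.≟ a
    ... | yes refl = k (inj₂ (x , inj₁ (fa , inj₁ refl) , trans e (lookup-updArg-same χ b (just x))))
    ... | no b≢a = free-after-binding {inj₁ a} {b} {x} {applyB Sg ♭ φ} (b≢a ∘ sym ∘ inj₁-injective) fa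
                     λ fa' → k (inj₁ (fa' , trans e (lookup-updArg-other χ (just x) b≢a)))

  occurs : Var → Maybe Var → Bool
  occurs x nothing = false
  occurs x (just y) = ⌊ y ℕ.≟ x ⌋

  occurs-self : ∀ y → occurs y (just y) ≡ true
  occurs-self y with y ℕ.≟ y
  ... | yes _ = refl
  ... | no y≢y = ⊥-elim (y≢y refl)

  occurs-other : ∀ {x y} → y ≢ x → occurs x (just y) ≡ false
  occurs-other {x} {y} y≢x with y ℕ.≟ x
  ... | yes y≡x = ⊥-elim (y≢x y≡x)
  ... | no _ = refl

  module Template (♭ : BPrefix Sg) (A : Subset nArgs) where

    -- the variable each argument is bound to by ♭
    names : ArgAsg Sg Var
    names = bindArgs ♭ (emptyArgAsg Sg) just

    slots : ArgAsg Sg Var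
    slots = restrict Sg A names

    -- the assignment seen by r̄ in environment η
    inst : ∀ {D : Set} → (Var → Maybe D) → ArgAsg Sg D
    inst η = map (_>>= η) slots

    holding : Var → Subset nArgs
    holding x = map (occurs x) slots

    lookup-inst : ∀ {D : Set} (η : Var → Maybe D) a →
                  lookup (inst η) a ≡ (if lookup A a then lookup names a >>= η else nothing)
    lookup-inst η a = trans (lookup-map a _ slots)
                            (trans (cong (_>>= η) (lookup-restrict A names a)) (masked (lookup A a)))
      where
      masked : ∀ b {m : Maybe Var} → ((if b then m else nothing) >>= η) ≡ (if b then m >>= η else nothing)
      masked true = refl
      masked false = refl

    inst-correct : ∀ {D : Set} (η : Var → Maybe D) → restrict Sg A (bindArgs ♭ (emptyArgAsg Sg) η) ≡ inst η
    inst-correct η = vecExt λ a → trans (lookup-restrict A _ a) (trans (entry a) (sym (lookup-inst η a)))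
      where
      open ≡-Reasoning
      bound : bindArgs ♭ (emptyArgAsg Sg) η ≡ map (_>>= η) names
      bound = begin
        bindArgs ♭ (emptyArgAsg Sg) η               ≡⟨ cong (λ χ → bindArgs ♭ χ η) (sym (map-replicate (_>>= η) nothing nArgs)) ⟩
        bindArgs ♭ (map (_>>= η) (emptyArgAsg Sg)) η ≡⟨ bindArgs-subst ♭ (emptyArgAsg Sg) η ⟩
        map (_>>= η) names                           ∎
      entry : ∀ a → (if lookup A a then lookup (bindArgs ♭ (emptyArgAsg Sg) η) a else nothing)
                  ≡ (if lookup A a then lookup names a >>= η else nothing)
      entry a = cong (λ m → if lookup A a then m else nothing)
                     (trans (cong (λ v → lookup v a) bound) (lookup-map a _ names))

    inst-empty : ∀ {D : Set} → inst {D} (λ _ → nothing) ≡ emptyArgAsg Sg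
    inst-empty = vecExt λ a → trans (lookup-map a _ slots) (trans (nowhere (lookup slots a)) (sym (lookup-replicate a nothing)))
      where
      nowhere : ∀ {D : Set} (m : Maybe Var) → (m >>= λ _ → nothing {A = D}) ≡ nothing
      nowhere nothing = refl
      nowhere (just _) = refl

    inst-update : ∀ {D : Set} (η : Var → Maybe D) x d → inst (updVar Sg η x d) ≡ updSet Sg (inst η) (holding x) d
    inst-update η x d = vecExt λ a →
      trans (lookup-map a _ slots)
        (trans (entry (lookup slots a))
          (sym (trans (lookup-updSet (inst η) (holding x) d a)
                 (cong₂ (λ b m → if b then just d else m) (lookup-map a (occurs x) slots) (lookup-map a _ slots)))))
      where
      entry : ∀ m → (m >>= updVar Sg η x d) ≡ (if occurs x m then just d else (m >>= η))
      entry nothing = refl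
      entry (just y) = by-cases (y ℕ.≟ x)
        where
        by-cases : Dec (y ≡ x) → updVar Sg η x d y ≡ (if occurs x (just y) then just d else η y)
        by-cases (yes refl) = trans (updVar-same η y d) (cong (λ b → if b then just d else η y) (sym (occurs-self y)))
        by-cases (no y≢x) = trans (updVar-other η x d y y≢x) (cong (λ b → if b then just d else η y) (sym (occurs-other y≢x)))

    holding-fresh : ∀ {D : Set} (η : Var → Maybe D) x → η x ≡ nothing → holding x ⊆ ∁ (dom Sg (inst η))
    holding-fresh η x ηx≡∅ {a} a∈P = lookup⇒[]= a _ (begin
        lookup (∁ (dom Sg (inst η))) a ≡⟨ lookup-map a not (dom Sg (inst η)) ⟩
        not (lookup (dom Sg (inst η)) a) ≡⟨ cong not (trans (lookup-dom (inst η) a) (cong is-just (lookup-map a _ slots))) ⟩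
        not (is-just (lookup slots a >>= η)) ≡⟨ entry (lookup slots a) (trans (sym (lookup-map a (occurs x) slots)) ([]=⇒lookup a∈P)) ⟩
        true ∎)
      where
      open ≡-Reasoning
      entry : ∀ m → occurs x m ≡ true → not (is-just (m >>= η)) ≡ true
      entry nothing ()
      entry (just y) e with y ℕ.≟ x
      entry (just y) e | yes refl = cong (not ∘ is-just) ηx≡∅
      entry (just y) () | no _

    -- Invariant of the quantifier walk: every argument of A is bound to a
    -- variable that is either still to be quantified (in vs) or defined in η.
    Covered : ∀ {D : Set} → (Var → Maybe D) → List Var → Set
    Covered η vs = ∀ a → lookup A a ≡ true →
                   Σ Var λ y → lookup names a ≡ just y × (y ∈ vs ⊎ is-just (η y) ≡ true)

    covered-update : ∀ {D : Set} (η : Var → Maybe D) x vs d → Covered η (x ∷ vs) → Covered (updVar Sg η x d) vs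
    covered-update η x vs d c a a∈A with c a a∈A
    ... | y , e , inj₁ (here refl) = y , e , inj₂ (cong is-just (updVar-same η y d))
    ... | y , e , inj₁ (there y∈) = y , e , inj₁ y∈
    ... | y , e , inj₂ def with y ℕ.≟ x
    ...   | yes refl = y , e , inj₂ (cong is-just (updVar-same η y d))
    ...   | no y≢x = y , e , inj₂ (trans (cong is-just (updVar-other η x d y y≢x)) def)

    dom-inst : ∀ {D : Set} (η : Var → Maybe D) → Covered η [] → dom Sg (inst η) ≡ A
    dom-inst η c = vecExt λ a → trans (lookup-dom (inst η) a) (trans (cong is-just (lookup-inst η a)) (entry a))
      where
      entry : ∀ a → is-just (if lookup A a then lookup names a >>= η else nothing) ≡ lookup A a
      entry a with lookup A a in a∈A
      ... | false = refl
      ... | true with c a a∈A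
      ...   | y , e , inj₂ def = trans (cong (λ m → is-just (m >>= η)) e) def

    covered-initially : ∀ {D : Set} ℘ {φ} → Derived Sg A φ → Sentence Sg (applyQ Sg ℘ (applyB Sg ♭ φ)) →
                        Covered {D} (λ _ → nothing) (lmap proj₂ ℘)
    covered-initially ℘ {φ} der closed a a∈A with quantified (lookup names a)
      where
      quantified : (m : Maybe Var) → Dec (Σ Var λ y → m ≡ just y × y ∈ lmap proj₂ ℘)
      quantified nothing = no λ { (_ , () , _) }
      quantified (just y) with y ∈? lmap proj₂ ℘
      ... | yes y∈ = yes (y , refl , y∈)
      ... | no y∉ = no λ { (_ , refl , y∈) → y∉ y∈ }
    ... | yes (y , e , y∈) = y , e , inj₁ y∈
    ... | no unquantified = ⊥-elim (argument-fate ♭ (emptyArgAsg Sg) (derived-free der a∈A) refute)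
      where
      refute : ¬ ArgumentFate ♭ (emptyArgAsg Sg) a φ
      refute (inj₁ (fa , _)) = closed (inj₁ a) (free-under-quantifiers ℘ {inj₁ a} {applyB Sg ♭ φ} fa λ _ ())
      refute (inj₂ (y , fy , e)) = closed (inj₂ y) (free-under-quantifiers ℘ {inj₂ y} {applyB Sg ♭ φ} fy λ { _ refl y∈ → unquantified (y , e , y∈) })

  module Bisimulation (R₁ R₂ : Structure Sg)
                      (Z : ArgAsg Sg (Structure.D R₁) → ArgAsg Sg (Structure.D R₂) → Set)
                      (isBisim : IsOneBindingBisim Sg R₁ R₂ Z) where
    open IsOneBindingBisim isBisim

    D₁ D₂ : Set
    D₁ = Structure.D R₁
    D₂ = Structure.D R₂

    derived-preserved : ∀ {A φ} → Derived Sg A φ → ∀ χ₁ χ₂ η₁ η₂ →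
                        Z (restrict Sg A χ₁) (restrict Sg A χ₂) →
                        dom Sg (restrict Sg A χ₁) ≡ A → dom Sg (restrict Sg A χ₂) ≡ A →
                        Sat Sg R₁ (χ₁ , η₁) φ ⇔ Sat Sg R₂ (χ₂ , η₂) φ
    derived-preserved (d-atom r refl) χ₁ χ₂ η₁ η₂ z e₁ e₂ = atomic r _ _ e₁ e₂ z
    derived-preserved (d-neg d) χ₁ χ₂ η₁ η₂ z e₁ e₂ = ¬-cong-⇔ (derived-preserved d χ₁ χ₂ η₁ η₂ z e₁ e₂)
    derived-preserved (d-and d d') χ₁ χ₂ η₁ η₂ z e₁ e₂ =
      derived-preserved d χ₁ χ₂ η₁ η₂ z e₁ e₂ ×-⇔ derived-preserved d' χ₁ χ₂ η₁ η₂ z e₁ e₂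
    derived-preserved (d-or d d') χ₁ χ₂ η₁ η₂ z e₁ e₂ =
      derived-preserved d χ₁ χ₂ η₁ η₂ z e₁ e₂ ⊎-⇔ derived-preserved d' χ₁ χ₂ η₁ η₂ z e₁ e₂

    empty-related : Z (emptyArgAsg Sg) (emptyArgAsg Sg)
    empty-related with total (emptyArgAsg Sg)
    ... | χ₂ , z = subst (Z (emptyArgAsg Sg)) (empty-dom χ₂ (trans (sym (sameDom z)) dom-emptyArgAsg)) z

    module Basic (♭ : BPrefix Sg) (A : Subset nArgs) (φ : Formula Sg) (der : Derived Sg A φ) where
      open Template ♭ A

      ψ : Formula Sg
      ψ = applyB Sg ♭ φ

      body-preserved : ∀ η₁ η₂ → Covered η₁ [] → Z (inst η₁) (inst η₂) →
                       Sat Sg R₁ (emptyArgAsg Sg , η₁) ψ ⇔ Sat Sg R₂ (emptyArgAsg Sg , η₂) ψ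
      body-preserved η₁ η₂ c z
        rewrite sat-bindings R₁ ♭ (emptyArgAsg Sg) η₁ φ | sat-bindings R₂ ♭ (emptyArgAsg Sg) η₂ φ =
        derived-preserved der _ _ η₁ η₂
          (subst₂ Z (sym (inst-correct η₁)) (sym (inst-correct η₂)) z)
          (trans (cong (dom Sg) (inst-correct η₁)) (dom-inst η₁ c))
          (trans (cong (dom Sg) (inst-correct η₂)) (trans (sym (sameDom z)) (dom-inst η₁ c)))

      prefix-preserved : ∀ ℘ → IsQPrefix Sg ℘ → ∀ η₁ η₂ →
                         (∀ y → y ∈ lmap proj₂ ℘ → η₁ y ≡ nothing) → Covered η₁ (lmap proj₂ ℘) →
                         Z (inst η₁) (inst η₂) →
                         Sat Sg R₁ (emptyArgAsg Sg , η₁) (applyQ Sg ℘ ψ) ⇔ Sat Sg R₂ (emptyArgAsg Sg , η₂) (applyQ Sg ℘ ψ)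
      prefix-preserved [] _ η₁ η₂ _ c z = body-preserved η₁ η₂ c z
      prefix-preserved ((q , x) ∷ ℘) (x∉℘ ∷ unique) η₁ η₂ fresh c z = quantifier q
        where
        disjoint : holding x ⊆ ∁ (dom Sg (inst η₁))
        disjoint = holding-fresh η₁ x (fresh x (here refl))
        Partner : D₁ → D₂ → Set
        Partner d₁ d₂ = Z (updSet Sg (inst η₁) (holding x) d₁) (updSet Sg (inst η₂) (holding x) d₂)
        step : ∀ {d₁ d₂} → Partner d₁ d₂ →
               Sat Sg R₁ (emptyArgAsg Sg , updVar Sg η₁ x d₁) (applyQ Sg ℘ ψ)
               ⇔ Sat Sg R₂ (emptyArgAsg Sg , updVar Sg η₂ x d₂) (applyQ Sg ℘ ψ)
        step {d₁} {d₂} p = prefix-preserved ℘ unique (updVar Sg η₁ x d₁) (updVar Sg η₂ x d₂)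
          (λ y y∈ → trans (updVar-other η₁ x d₁ y (≢-sym (All.lookup x∉℘ y∈))) (fresh y (there y∈)))
          (covered-update η₁ x _ d₁ c)
          (subst₂ Z (sym (inst-update η₁ x d₁)) (sym (inst-update η₂ x d₂)) p)
        open Transfer Partner
          (forth _ (holding x) disjoint _ _ refl (sym (sameDom z)) z)
          (back _ (holding x) disjoint _ _ refl (sym (sameDom z)) z) step
        quantifier : ∀ q → Sat Sg R₁ (emptyArgAsg Sg , η₁) (applyQ Sg ((q , x) ∷ ℘) ψ)
                         ⇔ Sat Sg R₂ (emptyArgAsg Sg , η₂) (applyQ Sg ((q , x) ∷ ℘) ψ)
        quantifier ex = Σ-transfer
        quantifier all = Π-transfer

      basic-preserved : ∀ ℘ → IsQPrefix Sg ℘ → Sentence Sg (applyQ Sg ℘ ψ) →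
                        Models Sg R₁ (applyQ Sg ℘ ψ) ⇔ Models Sg R₂ (applyQ Sg ℘ ψ)
      basic-preserved ℘ unique closed =
        prefix-preserved ℘ unique (λ _ → nothing) (λ _ → nothing) (λ _ _ → refl)
          (covered-initially {D₁} ℘ der closed)
          (subst₂ Z (sym inst-empty) (sym inst-empty) empty-related)

    preserved : ∀ φ → IsOBFOL Sg φ → Sentence Sg φ → Models Sg R₁ φ ⇔ Models Sg R₂ φ
    preserved _ (ob-basic ℘ ♭ φ unique _ (A , der)) closed = Basic.basic-preserved ♭ A φ der ℘ unique closed
    preserved _ (ob-and o o') closed with sentence-∧ closed
    ... | c , c' = preserved _ o c ×-⇔ preserved _ o' c'
    preserved _ (ob-or o o') closed with sentence-∨ closed
    ... | c , c' = preserved _ o c ⊎-⇔ preserved _ o' c'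

mainTheorem4 : (Sg : Signature) (R₁ R₂ : Structure Sg) →
    OneBindingBisimilar Sg R₁ R₂ →
    (φ : Formula Sg) → IsOBFOL Sg φ → Sentence Sg φ →
    (Models Sg R₁ φ ⇔ Models Sg R₂ φ)
mainTheorem4 Sg R₁ R₂ (Z , isBisim) = Bisimulation.preserved Sg R₁ R₂ Z isBisim
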